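{- There are infinitely many integers $b\ge 2$ for which there exist a positive integer $y$ and a word $w$ over $\{0,1,\dots,b-1\}$ with $|w|=1$ such that $(y^2)_b = w\uparrow 3$.
   Context: $(m)_b$ denotes the canonical base-$b$ representation of the integer $m$ (no leading zeros); $|w|$ is the length of the word $w$ and $w\uparrow n$ is the concatenation of $n$ copies of $w$. -}

module Defs where

open import Data.Nat using (ℕ; zero; suc; _+_; _*_)
open import Data.Fin using (Fin; toℕ)
open import Data.List using (List; []; _∷_; foldl; concat; replicate; length)
open import Data.Product using (_×_; ∃)
open import Data.Sum using (_⊎_)
open import Data.Empty using (⊥)
open import Relation.Binary.PropositionalEquality using (_≡_; _≢_)

-- A word over the alphabet {0,…,b-1}: a list of digits, most significant first.
Word : ℕ → Set
Word b = List (Fin b)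

value : (b : ℕ) → Word b → ℕ
value b = foldl (λ acc d → acc * b + toℕ d) 0

_↑_ : ∀ {b} → Word b → ℕ → Word b
w ↑ n = concat (replicate n w)

-- w is the canonical base-b representation (m)_b of m: no leading zeros,
-- with (0)_b being the single digit 0.
IsRepr : (b m : ℕ) → Word b → Set
IsRepr b m [] = ⊥
IsRepr b m (d ∷ w) = value b (d ∷ w) ≡ m × ((toℕ d ≢ 0) ⊎ (m ≡ 0 × w ≡ []))

{-# OPTIONS --safe #-}
module Submission where

-- The repdigit 333 in base b is 3 (b² + b + 1), the square of 3k exactly when
-- b² + b + 1 = 3k². This Pell-type equation has the solution (1, 1), and the
-- automorphism (b, k) ↦ (7b + 12k + 3, 4b + 7k + 2) of its quadratic form maps
-- solutions to strictly larger ones; any solution with b ≥ 4 makes 3 a digit.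

open import Defs
open import Data.Nat using (ℕ; zero; suc; _≥_; _*_; _^_; _+_; _≤_; _<_; s≤s; z≤n)
open import Data.Nat.Properties
  using (+-comm; +-cancelʳ-≡; +-monoʳ-≤; +-monoˡ-≤; m≤m+n; m≤n+m; m≤n*m; ≤-trans; module ≤-Reasoning)
open import Data.Nat.Tactic.RingSolver using (solve-∀)
open import Data.Fin using (Fin; fromℕ<; toℕ)
open import Data.Fin.Properties using (toℕ-fromℕ<)
open import Data.List using (List; length; []; _∷_)
open import Data.Product using (∃; ∃₂; _×_; _,_)
open import Data.Sum using (inj₁)
open import Relation.Binary.PropositionalEquality using (_≡_; _≢_; refl; sym; trans; cong)

RepunitIsTripleSquare : ℕ → ℕ → Set
RepunitIsTripleSquare b k = b * b + b + 1 ≡ 3 * (k * k)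

repunitIsTripleSquare-step : ∀ b k → RepunitIsTripleSquare b k →
  RepunitIsTripleSquare (7 * b + 3 + 12 * k) (4 * b + 2 + 7 * k)
repunitIsTripleSquare-step b k h =
  +-cancelʳ-≡ (3 * (k * k)) _ _ (trans (identity b k) (cong (3 * (k′ * k′) +_) h))
  where
  k′ : ℕ
  k′ = 4 * b + 2 + 7 * k
  -- Invariance of b² + b + 1 − 3k², with both sides moved to avoid subtraction.
  identity : ∀ b k →
    (7 * b + 3 + 12 * k) * (7 * b + 3 + 12 * k) + (7 * b + 3 + 12 * k) + 1 + 3 * (k * k)
      ≡ 3 * ((4 * b + 2 + 7 * k) * (4 * b + 2 + 7 * k)) + (b * b + b + 1)
  identity = solve-∀

repunitIsTripleSquare-unbounded : ∀ N → ∃₂ λ b k → N ≤ b × RepunitIsTripleSquare b k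
repunitIsTripleSquare-unbounded zero = 1 , 1 , z≤n , refl
repunitIsTripleSquare-unbounded (suc N) with repunitIsTripleSquare-unbounded N
... | b , k , N≤b , h = 7 * b + 3 + 12 * k , 4 * b + 2 + 7 * k , N<b′ , repunitIsTripleSquare-step b k h
  where
  open ≤-Reasoning
  N<b′ : suc N ≤ 7 * b + 3 + 12 * k
  N<b′ = begin
    suc N              ≤⟨ +-monoʳ-≤ 1 N≤b ⟩
    1 + b              ≤⟨ +-monoˡ-≤ b (s≤s z≤n) ⟩
    3 + b              ≡⟨ +-comm 3 b ⟩
    b + 3              ≤⟨ +-monoˡ-≤ 3 (m≤n*m b 7) ⟩
    7 * b + 3          ≤⟨ m≤m+n _ _ ⟩
    7 * b + 3 + 12 * k ∎

repunitIsTripleSquare⇒k≥1 : ∀ b k → RepunitIsTripleSquare b k → k ≥ 1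
repunitIsTripleSquare⇒k≥1 b zero h with trans (+-comm 1 (b * b + b)) h
... | ()
repunitIsTripleSquare⇒k≥1 b (suc k) h = s≤s z≤n

value-repdigit3 : ∀ b (d : Fin b) → value b ((d ∷ []) ↑ 3) ≡ toℕ d * (b * b + b + 1)
value-repdigit3 b d = identity b (toℕ d)
  where
  identity : ∀ b x → ((0 * b + x) * b + x) * b + x ≡ x * (b * b + b + 1)
  identity = solve-∀

repunitIsTripleSquare⇒333-square : ∀ b k → RepunitIsTripleSquare b k →
  3 * (b * b + b + 1) ≡ (3 * k) ^ 2
repunitIsTripleSquare⇒333-square b k h = trans (cong (3 *_) h) (identity k)
  where
  identity : ∀ k → 3 * (3 * (k * k)) ≡ (3 * k) * ((3 * k) * 1)
  identity = solve-∀

repdigit3-isRepr : ∀ {b m} (d : Fin b) → toℕ d ≢ 0 → toℕ d * (b * b + b + 1) ≡ m →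
  IsRepr b m ((d ∷ []) ↑ 3)
repdigit3-isRepr {b} d d≢0 eq = trans (value-repdigit3 b d) eq , inj₁ d≢0

mainTheorem8 : ∀ (N : ℕ) → ∃ λ (b : ℕ) → b ≥ N × b ≥ 2 ×
    (∃ λ (y : ℕ) → y ≥ 1 × (∃ λ (w : List (Fin b)) →
    length w ≡ 1 × IsRepr b (y ^ 2) (w ↑ 3)))
mainTheorem8 N with repunitIsTripleSquare-unbounded (N + 4)
... | b , k , N+4≤b , h =
  b , ≤-trans (m≤m+n N 4) N+4≤b , ≤-trans (s≤s (s≤s z≤n)) 3<b ,
  3 * k , ≤-trans (repunitIsTripleSquare⇒k≥1 b k h) (m≤m+n k _) , (three ∷ []) , refl ,
  repdigit3-isRepr three three≢0 (trans threeValue (repunitIsTripleSquare⇒333-square b k h))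
  where
  3<b : 3 < b
  3<b = ≤-trans (m≤n+m 4 N) N+4≤b
  three : Fin b
  three = fromℕ< 3<b
  threeValue : toℕ three * (b * b + b + 1) ≡ 3 * (b * b + b + 1)
  threeValue = cong (_* (b * b + b + 1)) (toℕ-fromℕ< 3<b)
  three≢0 : toℕ three ≢ 0
  three≢0 e with trans (sym (toℕ-fromℕ< 3<b)) e
  ... | ()
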